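{- Let $\mathcal A$ be a theory on $\Sigma$ and $\mathcal A^r$ a theory on $\Sigma^r$ such that: (i) for every individual constant $c^\sigma$ of $\Sigma$, $\mathcal A^r\vdash\mathrm{Rel}(c)$; (ii) for every $A\in\mathcal A$, $\mathcal A^r\vdash A^r$; (iii) for every sort $\sigma$ of $\Sigma$ there is a closed individual of sort $\sigma$. Then for every closed formula $A$ over $\Sigma$, $\mathcal A\vdash A$ implies $\mathcal A^r\vdash A^r$.
   Context: Logic. Sorts $\sigma,\tau::=\iota\mid\sigma\to\tau$ ($\iota$ base sorts). A signature $\Sigma$: base sorts, sorted individual constants, sorted predicates each declared negative or positive. Individuals $t::=c^\sigma\mid x^\sigma\mid(t\,u)$. Formulas $P(\vec t)\mid\bot\mid A\Rightarrow B\mid A\wedge B\mid\forall x^\sigma A$; $\neg A:=A\Rightarrow\bot$. Negative formulas: $N::=P(\vec t)$ ($P$ negative) $\mid\bot\mid A\Rightarrow N\mid N\wedge N'\mid\forall xN$. A theory is a set of closed formulas. Sequents $\Gamma\vdash A\mid\Delta$ with all formulas of $\Delta$ negative are derived by: $\Gamma,A\vdash A\mid\Delta$; $\Gamma\vdash A\mid\Delta$ for $A$ in the theory; from $\Gamma\vdash N\mid\Delta,N$ infer $\Gamma\vdash\bot\mid\Delta,N$; from $\Gamma\vdash\bot\mid\Delta,N$ infer $\Gamma\vdash N\mid\Delta$; $\Rightarrow$-intro (from $\Gamma,A\vdash B\mid\Delta$ infer $\Gamma\vdash A\Rightarrow B\mid\Delta$) and $\Rightarrow$-elim (modus ponens);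 $\wedge$-intro and $\wedge$-elim; from $\Gamma\vdash A\mid\Delta$, $x$ not free in $\Gamma,\Delta$, infer $\Gamma\vdash\forall xA\mid\Delta$; from $\Gamma\vdash\forall x^\sigma A\mid\Delta$ infer $\Gamma\vdash A[t/x]\mid\Delta$ for any individual $t^\sigma$. $\mathcal A\vdash A$ means $\vdash A\mid$ (empty contexts) is derivable from axioms $\mathcal A$. Relativization. $\Sigma^r$ is $\Sigma$ plus, for each base sort $\iota$, a positive unary predicate $\mathrm{Rel}$ on $\iota$; at arrow sorts $\mathrm{Rel}(t^{\sigma\to\tau}):=\forall x^\sigma(\mathrm{Rel}(x)\Rightarrow\mathrm{Rel}(t\,x))$. $\forall^rxA:=\forall x(\mathrm{Rel}(x)\Rightarrow A)$. The relativization $A^r$ of a formula over $\Sigma$: $P(\vec t)^r=P(\vec t)$, $\bot^r=\bot$, $(A\Rightarrow B)^r=A^r\Rightarrow B^r$, $(A\wedge B)^r=A^r\wedge B^r$, $(\forall xA)^r=\forall^rxA^r$. -}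

module Defs where

open import Data.Bool using (Bool; true; false)
open import Data.List using (List; []; _∷_; map)
open import Data.List.Membership.Propositional using (_∈_)
open import Data.List.Relation.Unary.Any using (here; there)
open import Data.List.Relation.Unary.All as All using (All; []; _∷_)
open import Data.Product using (Σ; _,_)
open import Relation.Binary.PropositionalEquality using (_≡_; refl)

infixr 30 _⟶_
data Sort (B : Set) : Set where
  base : B → Sort B
  _⟶_  : Sort B → Sort B → Sort B

record Signature : Set₁ where
  field
    BaseSort : Set
    Const    : Sort BaseSort → Set
    Pred     : List (Sort BaseSort) → Set
    negative : ∀ {ss} → Pred ss → Bool

open Signature public

Ctx : Signature → Set
Ctx S = List (Sort (BaseSort S))

data Term (S : Signature) (Ξ : Ctx S) : Sort (BaseSort S) → Set where
  const : ∀ {σ} → Const S σ → Term S Ξ σ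
  var   : ∀ {σ} → σ ∈ Ξ → Term S Ξ σ
  app   : ∀ {σ τ} → Term S Ξ (σ ⟶ τ) → Term S Ξ σ → Term S Ξ τ

infixr 20 _⇒_
infixr 25 _∧_
data Form (S : Signature) : Ctx S → Set where
  atom : ∀ {Ξ ss} → Pred S ss → All (Term S Ξ) ss → Form S Ξ
  ⊥'   : ∀ {Ξ} → Form S Ξ
  _⇒_  : ∀ {Ξ} → Form S Ξ → Form S Ξ → Form S Ξ
  _∧_  : ∀ {Ξ} → Form S Ξ → Form S Ξ → Form S Ξ
  ∀'   : ∀ {Ξ} (σ : Sort (BaseSort S)) → Form S (σ ∷ Ξ) → Form S Ξ

¬' : ∀ {S Ξ} → Form S Ξ → Form S Ξ
¬' A = A ⇒ ⊥'

data Negative {S : Signature} : ∀ {Ξ} → Form S Ξ → Set where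
  atom : ∀ {Ξ ss} {P : Pred S ss} {ts : All (Term S Ξ) ss} →
         negative S P ≡ true → Negative (atom P ts)
  ⊥'   : ∀ {Ξ} → Negative {Ξ = Ξ} ⊥'
  _⇒_  : ∀ {Ξ} (A : Form S Ξ) {N : Form S Ξ} → Negative N → Negative (A ⇒ N)
  _∧_  : ∀ {Ξ} {N N' : Form S Ξ} → Negative N → Negative N' → Negative (N ∧ N')
  ∀'   : ∀ {Ξ σ} {N : Form S (σ ∷ Ξ)} → Negative N → Negative (∀' σ N)

Theory : Signature → Set₁
Theory S = Form S [] → Set

Ren : (S : Signature) → Ctx S → Ctx S → Set
Ren S Ξ Ξ' = ∀ {σ} → σ ∈ Ξ → σ ∈ Ξ'

liftR : ∀ {S Ξ Ξ' σ} → Ren S Ξ Ξ' → Ren S (σ ∷ Ξ) (σ ∷ Ξ')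
liftR ρ (here p)  = here p
liftR ρ (there x) = there (ρ x)

renT : ∀ {S Ξ Ξ' σ} → Ren S Ξ Ξ' → Term S Ξ σ → Term S Ξ' σ
renT ρ (const c) = const c
renT ρ (var x)   = var (ρ x)
renT ρ (app t u) = app (renT ρ t) (renT ρ u)

renF : ∀ {S Ξ Ξ'} → Ren S Ξ Ξ' → Form S Ξ → Form S Ξ'
renF ρ (atom P ts) = atom P (All.map (renT ρ) ts)
renF ρ ⊥'          = ⊥'
renF ρ (A ⇒ B)     = renF ρ A ⇒ renF ρ B
renF ρ (A ∧ B)     = renF ρ A ∧ renF ρ B
renF {S} ρ (∀' σ A) = ∀' σ (renF (liftR {S} {σ = σ} ρ) A)

wkT : ∀ {S Ξ σ τ} → Term S Ξ σ → Term S (τ ∷ Ξ) σ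
wkT = renT there

wkF : ∀ {S Ξ τ} → Form S Ξ → Form S (τ ∷ Ξ)
wkF = renF there

close : ∀ {S Ξ} → Form S [] → Form S Ξ
close = renF (λ {_} ())

Sub : (S : Signature) → Ctx S → Ctx S → Set
Sub S Ξ Ξ' = ∀ {σ} → σ ∈ Ξ → Term S Ξ' σ

liftS : ∀ {S Ξ Ξ' σ} → Sub S Ξ Ξ' → Sub S (σ ∷ Ξ) (σ ∷ Ξ')
liftS θ (here p)  = var (here p)
liftS θ (there x) = wkT (θ x)

subT : ∀ {S Ξ Ξ' σ} → Sub S Ξ Ξ' → Term S Ξ σ → Term S Ξ' σ
subT θ (const c) = const c
subT θ (var x)   = θ x
subT θ (app t u) = app (subT θ t) (subT θ u)

subF : ∀ {S Ξ Ξ'} → Sub S Ξ Ξ' → Form S Ξ → Form S Ξ'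
subF θ (atom P ts) = atom P (All.map (subT θ) ts)
subF θ ⊥'          = ⊥'
subF θ (A ⇒ B)     = subF θ A ⇒ subF θ B
subF θ (A ∧ B)     = subF θ A ∧ subF θ B
subF θ (∀' σ A)    = ∀' σ (subF (liftS {σ = σ} θ) A)

single : ∀ {S Ξ σ} → Term S Ξ σ → Sub S (σ ∷ Ξ) Ξ
single t (here refl) = t
single t (there x)   = var x

-- A [ t / x ]  (x the last-bound variable)
_[_] : ∀ {S Ξ σ} → Form S (σ ∷ Ξ) → Term S Ξ σ → Form S Ξ
A [ t ] = subF (single t) A

-- Deduction:  Γ ⊢ A ∣ Δ  in variable context Ξ, over theory T.
-- Δ only ever receives negative formulas (checked in the rule that
-- extends Δ), so every Δ occurring in a derivation from Δ = [] is negative.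

data Deriv {S : Signature} (T : Theory S) :
       (Ξ : Ctx S) → List (Form S Ξ) → Form S Ξ → List (Form S Ξ) → Set where
  hyp   : ∀ {Ξ Γ Δ A} → A ∈ Γ → Deriv T Ξ Γ A Δ
  axiom : ∀ {Ξ Γ Δ A} → T A → Deriv T Ξ Γ (close A) Δ
  throw : ∀ {Ξ Γ Δ N} → N ∈ Δ → Deriv T Ξ Γ N Δ → Deriv T Ξ Γ ⊥' Δ
  catch : ∀ {Ξ Γ Δ N} → Negative N → Deriv T Ξ Γ ⊥' (N ∷ Δ) → Deriv T Ξ Γ N Δ
  ⇒I    : ∀ {Ξ Γ Δ A B} → Deriv T Ξ (A ∷ Γ) B Δ → Deriv T Ξ Γ (A ⇒ B) Δ
  ⇒E    : ∀ {Ξ Γ Δ A B} → Deriv T Ξ Γ (A ⇒ B) Δ → Deriv T Ξ Γ A Δ → Deriv T Ξ Γ B Δ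
  ∧I    : ∀ {Ξ Γ Δ A B} → Deriv T Ξ Γ A Δ → Deriv T Ξ Γ B Δ → Deriv T Ξ Γ (A ∧ B) Δ
  ∧E₁   : ∀ {Ξ Γ Δ A B} → Deriv T Ξ Γ (A ∧ B) Δ → Deriv T Ξ Γ A Δ
  ∧E₂   : ∀ {Ξ Γ Δ A B} → Deriv T Ξ Γ (A ∧ B) Δ → Deriv T Ξ Γ B Δ
  -- x not free in Γ, Δ: Γ and Δ are weakened into the extended context
  ∀I    : ∀ {Ξ Γ Δ σ A} → Deriv T (σ ∷ Ξ) (map wkF Γ) A (map wkF Δ) →
          Deriv T Ξ Γ (∀' σ A) Δ
  ∀E    : ∀ {Ξ Γ Δ σ A} → Deriv T Ξ Γ (∀' σ A) Δ → (t : Term S Ξ σ) →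
          Deriv T Ξ Γ (A [ t ]) Δ

-- 𝒜 ⊢ A  for closed A: ⊢ A ∣ is derivable; the derivation may use
-- free variables of any sorts (collected in Ξ).
_⊩_ : ∀ {S} → Theory S → Form S [] → Set
_⊩_ {S} T A = Σ (Ctx S) λ Ξ → Deriv T Ξ [] (close A) []

data RPred (S : Signature) : List (Sort (BaseSort S)) → Set where
  old : ∀ {ss} → Pred S ss → RPred S ss
  rel : (b : BaseSort S) → RPred S (base b ∷ [])

rnegative : ∀ {S ss} → RPred S ss → Bool
rnegative {S} (old P) = negative S P
rnegative (rel b)     = false

_ʳ : Signature → Signature
S ʳ = record
  { BaseSort = BaseSort S
  ; Const    = Const S
  ; Pred     = RPred S
  ; negative = rnegative
  }

toRT : ∀ {S Ξ σ} → Term S Ξ σ → Term (S ʳ) Ξ σ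
toRT (const c) = const c
toRT (var x)   = var x
toRT (app t u) = app (toRT t) (toRT u)

Rel : ∀ {S Ξ σ} → Term (S ʳ) Ξ σ → Form (S ʳ) Ξ
Rel {σ = base b}  t = atom (rel b) (t ∷ [])
Rel {σ = σ ⟶ τ} t = ∀' σ (Rel (var (here refl)) ⇒ Rel (app (wkT t) (var (here refl))))

∀ʳ : ∀ {S Ξ} (σ : Sort (BaseSort S)) → Form (S ʳ) (σ ∷ Ξ) → Form (S ʳ) Ξ
∀ʳ σ A = ∀' σ (Rel (var (here refl)) ⇒ A)

_ʳᶠ : ∀ {S Ξ} → Form S Ξ → Form (S ʳ) Ξ
atom P ts ʳᶠ = atom (old P) (All.map toRT ts)
⊥'        ʳᶠ = ⊥'
(A ⇒ B)   ʳᶠ = (A ʳᶠ) ⇒ (B ʳᶠ)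
(A ∧ B)   ʳᶠ = (A ʳᶠ) ∧ (B ʳᶠ)
∀' σ A    ʳᶠ = ∀ʳ σ (A ʳᶠ)

-- Translate a derivation of Γ ⊢ A ∣ Δ with free variables x₁ … xₙ into one of
-- Rel(x₁), …, Rel(xₙ), Γʳ ⊢ Aʳ ∣ Δʳ, by induction on the derivation. Relativization
-- preserves negativity, so the classical rules survive unchanged; ∀-introduction
-- acquires the hypothesis Rel(x), discharged by ⇒-introduction; ∀-elimination at an
-- individual t needs Rel(t), which follows by induction on t from (i) and the Rel
-- hypotheses of its variables. A derivation of a closed formula may still use free
-- variables, whose relativity we cannot assume: (iii) lets us substitute closed
-- individuals for them beforehand, and likewise instantiate the derivations given by
-- (i) and (ii) in an arbitrary context.
module Submission where

open import Defs
open import Data.List using (List; []; _∷_; map)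
open import Data.List.Membership.Propositional using (_∈_)
open import Data.List.Membership.Propositional.Properties using (∈-map⁺; ∈-map⁻)
open import Data.List.Relation.Unary.Any using (here; there)
import Data.List.Relation.Unary.All.Properties as All
open import Data.Product using (_,_)
open import Relation.Binary.PropositionalEquality hiding ([_])
open ≡-Reasoning

_⊆⟨_⟩_ : {X Y : Set} → List X → (X → Y) → List Y → Set
L ⊆⟨ f ⟩ L' = ∀ {x} → x ∈ L → f x ∈ L'

⊆⟨⟩-∷ : ∀ {X Y} {f : X → Y} {L L' x} → L ⊆⟨ f ⟩ L' → (x ∷ L) ⊆⟨ f ⟩ (f x ∷ L')
⊆⟨⟩-∷ h (here refl) = here refl
⊆⟨⟩-∷ h (there m)   = there (h m)

⊆⟨⟩-map : ∀ {X Y X' Y'} {f : X → Y} {g : X' → Y'} {w : X → X'} {w' : Y → Y'} {L L'} →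
          (∀ x → g (w x) ≡ w' (f x)) → L ⊆⟨ f ⟩ L' → map w L ⊆⟨ g ⟩ map w' L'
⊆⟨⟩-map {w = w} {w'} commute h m with ∈-map⁻ w m
... | x , m₀ , refl = subst (_∈ _) (sym (commute x)) (∈-map⁺ w' (h m₀))

cast : ∀ {S} {T : Theory S} {Ξ Γ Δ A B} → A ≡ B → Deriv T Ξ Γ A Δ → Deriv T Ξ Γ B Δ
cast refl D = D

module _ {S : Signature} where

  infix 4 _≗ˢ_
  _≗ˢ_ : ∀ {Ξ Ξ'} → Sub S Ξ Ξ' → Sub S Ξ Ξ' → Set
  θ ≗ˢ θ' = ∀ {σ} (x : σ ∈ _) → θ x ≡ θ' x

  varˢ : ∀ {Ξ Ξ'} → Ren S Ξ Ξ' → Sub S Ξ Ξ'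
  varˢ ρ x = var (ρ x)

  infixr 9 _∘ˢ_
  _∘ˢ_ : ∀ {Ξ₁ Ξ₂ Ξ₃} → Sub S Ξ₂ Ξ₃ → Sub S Ξ₁ Ξ₂ → Sub S Ξ₁ Ξ₃
  (θ ∘ˢ θ') x = subT θ (θ' x)

  subT-cong : ∀ {Ξ Ξ' σ} {θ θ' : Sub S Ξ Ξ'} → θ ≗ˢ θ' → (t : Term S Ξ σ) → subT θ t ≡ subT θ' t
  subT-cong e (const c) = refl
  subT-cong e (var x)   = e x
  subT-cong e (app t u) = cong₂ app (subT-cong e t) (subT-cong e u)

  subT-var : ∀ {Ξ σ} (t : Term S Ξ σ) → subT var t ≡ t
  subT-var (const c) = refl
  subT-var (var x)   = refl
  subT-var (app t u) = cong₂ app (subT-var t) (subT-var u)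

  renT-subT : ∀ {Ξ Ξ' σ} (ρ : Ren S Ξ Ξ') (t : Term S Ξ σ) → renT ρ t ≡ subT (varˢ ρ) t
  renT-subT ρ (const c) = refl
  renT-subT ρ (var x)   = refl
  renT-subT ρ (app t u) = cong₂ app (renT-subT ρ t) (renT-subT ρ u)

  subT-∘ : ∀ {Ξ₁ Ξ₂ Ξ₃ σ} (θ : Sub S Ξ₂ Ξ₃) (θ' : Sub S Ξ₁ Ξ₂) (t : Term S Ξ₁ σ) →
           subT θ (subT θ' t) ≡ subT (θ ∘ˢ θ') t
  subT-∘ θ θ' (const c) = refl
  subT-∘ θ θ' (var x)   = refl
  subT-∘ θ θ' (app t u) = cong₂ app (subT-∘ θ θ' t) (subT-∘ θ θ' u)

  subT-wkT : ∀ {Ξ Ξ' σ τ} (θ : Sub S Ξ Ξ') (t : Term S Ξ σ) →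
             subT (liftS {σ = τ} θ) (wkT t) ≡ wkT (subT θ t)
  subT-wkT θ t = begin
    subT (liftS θ) (wkT t)               ≡⟨ cong (subT (liftS θ)) (renT-subT there t) ⟩
    subT (liftS θ) (subT (varˢ there) t) ≡⟨ subT-∘ (liftS θ) (varˢ there) t ⟩
    subT (λ x → wkT (θ x)) t             ≡⟨ subT-cong (λ x → renT-subT there (θ x)) t ⟩
    subT (varˢ there ∘ˢ θ) t             ≡⟨ subT-∘ (varˢ there) θ t ⟨
    subT (varˢ there) (subT θ t)         ≡⟨ renT-subT there (subT θ t) ⟨
    wkT (subT θ t)                       ∎

  single-wkT : ∀ {Ξ σ τ} (u : Term S Ξ τ) (t : Term S Ξ σ) → subT (single u) (wkT t) ≡ t
  single-wkT u t = begin
    subT (single u) (wkT t)               ≡⟨ cong (subT (single u)) (renT-subT there t) ⟩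
    subT (single u) (subT (varˢ there) t) ≡⟨ subT-∘ (single u) (varˢ there) t ⟩
    subT var t                            ≡⟨ subT-var t ⟩
    t                                     ∎

  liftS-cong : ∀ {Ξ Ξ' τ} {θ θ' : Sub S Ξ Ξ'} → θ ≗ˢ θ' → liftS {σ = τ} θ ≗ˢ liftS θ'
  liftS-cong e (here p)  = refl
  liftS-cong e (there x) = cong wkT (e x)

  liftS-∘ : ∀ {Ξ₁ Ξ₂ Ξ₃ τ} (θ : Sub S Ξ₂ Ξ₃) (θ' : Sub S Ξ₁ Ξ₂) →
            liftS {σ = τ} θ ∘ˢ liftS θ' ≗ˢ liftS (θ ∘ˢ θ')
  liftS-∘ θ θ' (here p)  = refl
  liftS-∘ θ θ' (there x) = subT-wkT θ (θ' x)

  subF-cong : ∀ {Ξ Ξ'} {θ θ' : Sub S Ξ Ξ'} → θ ≗ˢ θ' → (A : Form S Ξ) → subF θ A ≡ subF θ' A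
  subF-cong e (atom P ts) = cong (atom P) (All.map-cong ts (subT-cong e))
  subF-cong e ⊥'          = refl
  subF-cong e (A ⇒ B)     = cong₂ _⇒_ (subF-cong e A) (subF-cong e B)
  subF-cong e (A ∧ B)     = cong₂ _∧_ (subF-cong e A) (subF-cong e B)
  subF-cong e (∀' σ A)    = cong (∀' σ) (subF-cong (liftS-cong e) A)

  renF-subF : ∀ {Ξ Ξ'} (ρ : Ren S Ξ Ξ') (A : Form S Ξ) → renF ρ A ≡ subF (varˢ ρ) A
  renF-subF ρ (atom P ts) = cong (atom P) (All.map-cong ts (renT-subT ρ))
  renF-subF ρ ⊥'          = refl
  renF-subF ρ (A ⇒ B)     = cong₂ _⇒_ (renF-subF ρ A) (renF-subF ρ B)
  renF-subF ρ (A ∧ B)     = cong₂ _∧_ (renF-subF ρ A) (renF-subF ρ B)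
  renF-subF ρ (∀' σ A)    = cong (∀' σ) (trans (renF-subF (liftR ρ) A) (subF-cong varˢ-liftR A))
    where
    varˢ-liftR : varˢ (liftR ρ) ≗ˢ liftS (varˢ ρ)
    varˢ-liftR (here p)  = refl
    varˢ-liftR (there x) = refl

  subF-∘ : ∀ {Ξ₁ Ξ₂ Ξ₃} (θ : Sub S Ξ₂ Ξ₃) (θ' : Sub S Ξ₁ Ξ₂) (A : Form S Ξ₁) →
           subF θ (subF θ' A) ≡ subF (θ ∘ˢ θ') A
  subF-∘ θ θ' (atom P ts) = cong (atom P) (trans (All.map-∘ ts) (All.map-cong ts (subT-∘ θ θ')))
  subF-∘ θ θ' ⊥'          = refl
  subF-∘ θ θ' (A ⇒ B)     = cong₂ _⇒_ (subF-∘ θ θ' A) (subF-∘ θ θ' B)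
  subF-∘ θ θ' (A ∧ B)     = cong₂ _∧_ (subF-∘ θ θ' A) (subF-∘ θ θ' B)
  subF-∘ θ θ' (∀' σ A)    =
    cong (∀' σ) (trans (subF-∘ (liftS θ) (liftS θ') A) (subF-cong (liftS-∘ θ θ') A))

  subF-renF : ∀ {Ξ₁ Ξ₂ Ξ₃} (θ : Sub S Ξ₂ Ξ₃) (ρ : Ren S Ξ₁ Ξ₂) (A : Form S Ξ₁) →
              subF θ (renF ρ A) ≡ subF (λ x → θ (ρ x)) A
  subF-renF θ ρ A = trans (cong (subF θ) (renF-subF ρ A)) (subF-∘ θ (varˢ ρ) A)

  subF-wkF : ∀ {Ξ Ξ' τ} (θ : Sub S Ξ Ξ') (A : Form S Ξ) →
             subF (liftS {σ = τ} θ) (wkF A) ≡ wkF (subF θ A)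
  subF-wkF θ A = begin
    subF (liftS θ) (wkF A)        ≡⟨ subF-renF (liftS θ) there A ⟩
    subF (λ x → wkT (θ x)) A      ≡⟨ subF-cong (λ x → renT-subT there (θ x)) A ⟩
    subF (varˢ there ∘ˢ θ) A      ≡⟨ subF-∘ (varˢ there) θ A ⟨
    subF (varˢ there) (subF θ A)  ≡⟨ renF-subF there (subF θ A) ⟨
    wkF (subF θ A)                ∎

  subF-[] : ∀ {Ξ Ξ' σ} (θ : Sub S Ξ Ξ') (A : Form S (σ ∷ Ξ)) (t : Term S Ξ σ) →
            subF θ (A [ t ]) ≡ subF (liftS θ) A [ subT θ t ]
  subF-[] θ A t = begin
    subF θ (A [ t ])                      ≡⟨ subF-∘ θ (single t) A ⟩
    subF (θ ∘ˢ single t) A                ≡⟨ subF-cong single-liftS A ⟩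
    subF (single (subT θ t) ∘ˢ liftS θ) A ≡⟨ subF-∘ (single (subT θ t)) (liftS θ) A ⟨
    subF (liftS θ) A [ subT θ t ]         ∎
    where
    single-liftS : θ ∘ˢ single t ≗ˢ single (subT θ t) ∘ˢ liftS θ
    single-liftS (here refl) = refl
    single-liftS (there x)   = sym (single-wkT (subT θ t) (θ x))

  subF-close : ∀ {Ξ Ξ'} (θ : Sub S Ξ Ξ') (A : Form S []) → subF θ (close A) ≡ close A
  subF-close θ A = trans (subF-renF θ _ A) (trans (subF-cong (λ ()) A) (sym (renF-subF _ A)))

  Negative-subF : ∀ {Ξ Ξ'} (θ : Sub S Ξ Ξ') {N : Form S Ξ} → Negative N → Negative (subF θ N)
  Negative-subF θ (atom e) = atom e
  Negative-subF θ ⊥'       = ⊥'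
  Negative-subF θ (A ⇒ n)  = subF θ A ⇒ Negative-subF θ n
  Negative-subF θ (n ∧ n') = Negative-subF θ n ∧ Negative-subF θ n'
  Negative-subF θ (∀' n)   = ∀' (Negative-subF (liftS θ) n)

  subDeriv : ∀ {T : Theory S} {Ξ Ξ' Γ Δ A Γ' Δ'} (θ : Sub S Ξ Ξ') →
             Γ ⊆⟨ subF θ ⟩ Γ' → Δ ⊆⟨ subF θ ⟩ Δ' →
             Deriv T Ξ Γ A Δ → Deriv T Ξ' Γ' (subF θ A) Δ'
  subDeriv θ g d (hyp m)           = hyp (g m)
  subDeriv θ g d (axiom {A = A} a) = cast (sym (subF-close θ A)) (axiom a)
  subDeriv θ g d (throw m D)       = throw (d m) (subDeriv θ g d D)
  subDeriv θ g d (catch n D)       = catch (Negative-subF θ n) (subDeriv θ g (⊆⟨⟩-∷ d) D)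
  subDeriv θ g d (⇒I D)            = ⇒I (subDeriv θ (⊆⟨⟩-∷ g) d D)
  subDeriv θ g d (⇒E D E)          = ⇒E (subDeriv θ g d D) (subDeriv θ g d E)
  subDeriv θ g d (∧I D E)          = ∧I (subDeriv θ g d D) (subDeriv θ g d E)
  subDeriv θ g d (∧E₁ D)           = ∧E₁ (subDeriv θ g d D)
  subDeriv θ g d (∧E₂ D)           = ∧E₂ (subDeriv θ g d D)
  subDeriv θ g d (∀I D)            =
    ∀I (subDeriv (liftS θ) (⊆⟨⟩-map (subF-wkF θ) g) (⊆⟨⟩-map (subF-wkF θ) d) D)
  subDeriv θ g d (∀E {A = A} D t)  = cast (sym (subF-[] θ A t)) (∀E (subDeriv θ g d D) (subT θ t))

  ⊩⇒Deriv : ∀ {T : Theory S} {Ξ Γ Δ} {A : Form S []} →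
            (∀ σ → Term S [] σ) → T ⊩ A → Deriv T Ξ Γ (close A) Δ
  ⊩⇒Deriv {A = A} closed (_ , D) =
    cast (subF-close closedSub A) (subDeriv closedSub (λ ()) (λ ()) D)
    where
    closedSub : ∀ {Ξ Ξ'} → Sub S Ξ Ξ'
    closedSub {σ = σ} _ = renT (λ ()) (closed σ)

module _ {S : Signature} where

  Rel-subF : ∀ {Ξ Ξ' σ} (θ : Sub (S ʳ) Ξ Ξ') (t : Term (S ʳ) Ξ σ) →
             subF θ (Rel {S} t) ≡ Rel (subT θ t)
  Rel-subF {σ = base b}  θ t = refl
  Rel-subF {σ = σ ⟶ τ} θ t = cong (∀' σ) (cong₂ _⇒_
    (Rel-subF (liftS θ) (var (here refl)))
    (trans (Rel-subF (liftS θ) (app (wkT t) (var (here refl))))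
           (cong (λ u → Rel (app u (var (here refl)))) (subT-wkT θ t))))

  Rel-renF : ∀ {Ξ Ξ' σ} (ρ : Ren (S ʳ) Ξ Ξ') (t : Term (S ʳ) Ξ σ) →
             renF ρ (Rel {S} t) ≡ Rel (renT ρ t)
  Rel-renF ρ t = begin
    renF ρ (Rel t)           ≡⟨ renF-subF ρ (Rel t) ⟩
    subF (varˢ ρ) (Rel t)    ≡⟨ Rel-subF (varˢ ρ) t ⟩
    Rel (subT (varˢ ρ) t)    ≡⟨ cong Rel (renT-subT ρ t) ⟨
    Rel (renT ρ t)           ∎

  ∀ʳE : ∀ {T : Theory (S ʳ)} {Ξ Γ Δ σ} {A : Form (S ʳ) (σ ∷ Ξ)} →
        Deriv T Ξ Γ (∀ʳ σ A) Δ → (t : Term (S ʳ) Ξ σ) → Deriv T Ξ Γ (Rel t) Δ →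
        Deriv T Ξ Γ (A [ t ]) Δ
  ∀ʳE {A = A} D t R =
    ⇒E (cast (cong (_⇒ (A [ t ])) (Rel-subF (single t) (var (here refl)))) (∀E D t)) R

  toRT-subT : ∀ {Ξ Ξ' σ} (θ : Sub S Ξ Ξ') (t : Term S Ξ σ) →
              toRT (subT θ t) ≡ subT (λ x → toRT (θ x)) (toRT t)
  toRT-subT θ (const c) = refl
  toRT-subT θ (var x)   = refl
  toRT-subT θ (app t u) = cong₂ app (toRT-subT θ t) (toRT-subT θ u)

  toRT-renT : ∀ {Ξ Ξ' σ} (ρ : Ren S Ξ Ξ') (t : Term S Ξ σ) → toRT (renT ρ t) ≡ renT ρ (toRT t)
  toRT-renT ρ (const c) = refl
  toRT-renT ρ (var x)   = refl
  toRT-renT ρ (app t u) = cong₂ app (toRT-renT ρ t) (toRT-renT ρ u)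

  ʳᶠ-subF : ∀ {Ξ Ξ'} (θ : Sub S Ξ Ξ') (A : Form S Ξ) →
            subF θ A ʳᶠ ≡ subF (λ x → toRT (θ x)) (A ʳᶠ)
  ʳᶠ-subF θ (atom P ts) =
    cong (atom (old P)) (trans (All.map-∘ ts) (trans (All.map-cong ts (toRT-subT θ)) (sym (All.map-∘ ts))))
  ʳᶠ-subF θ ⊥'       = refl
  ʳᶠ-subF θ (A ⇒ B)  = cong₂ _⇒_ (ʳᶠ-subF θ A) (ʳᶠ-subF θ B)
  ʳᶠ-subF θ (A ∧ B)  = cong₂ _∧_ (ʳᶠ-subF θ A) (ʳᶠ-subF θ B)
  ʳᶠ-subF θ (∀' σ A) = cong (∀' σ) (cong₂ _⇒_
    (sym (Rel-subF _ (var (here refl))))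
    (trans (ʳᶠ-subF (liftS θ) A) (subF-cong toRT-liftS (A ʳᶠ))))
    where
    toRT-liftS : (λ {τ} (x : τ ∈ σ ∷ _) → toRT (liftS θ x)) ≗ˢ liftS (λ x → toRT (θ x))
    toRT-liftS (here p)  = refl
    toRT-liftS (there x) = toRT-renT there (θ x)

  ʳᶠ-renF : ∀ {Ξ Ξ'} (ρ : Ren S Ξ Ξ') (A : Form S Ξ) → renF ρ A ʳᶠ ≡ renF ρ (A ʳᶠ)
  ʳᶠ-renF ρ A = begin
    renF ρ A ʳᶠ                ≡⟨ cong _ʳᶠ (renF-subF ρ A) ⟩
    subF (varˢ ρ) A ʳᶠ         ≡⟨ ʳᶠ-subF (varˢ ρ) A ⟩
    subF (varˢ ρ) (A ʳᶠ)       ≡⟨ renF-subF ρ (A ʳᶠ) ⟨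
    renF ρ (A ʳᶠ)              ∎

  ʳᶠ-[] : ∀ {Ξ σ} (A : Form S (σ ∷ Ξ)) (t : Term S Ξ σ) → A [ t ] ʳᶠ ≡ (A ʳᶠ) [ toRT t ]
  ʳᶠ-[] A t = trans (ʳᶠ-subF (single t) A) (subF-cong toRT-single (A ʳᶠ))
    where
    toRT-single : (λ {τ} x → toRT (single t x)) ≗ˢ single (toRT t)
    toRT-single (here refl) = refl
    toRT-single (there x)   = refl

  Negative-ʳᶠ : ∀ {Ξ} {N : Form S Ξ} → Negative N → Negative (N ʳᶠ)
  Negative-ʳᶠ (atom e) = atom e
  Negative-ʳᶠ ⊥'       = ⊥'
  Negative-ʳᶠ (A ⇒ n)  = (A ʳᶠ) ⇒ Negative-ʳᶠ n
  Negative-ʳᶠ (n ∧ n') = Negative-ʳᶠ n ∧ Negative-ʳᶠ n'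
  Negative-ʳᶠ (∀' n)   = ∀' (_ ⇒ Negative-ʳᶠ n)

  AssumesRel : (Ξ : Ctx S) → List (Form (S ʳ) Ξ) → Set
  AssumesRel Ξ Γ = ∀ {τ} (x : τ ∈ Ξ) → Rel {S} (var x) ∈ Γ

  AssumesRel-∷ : ∀ {Ξ σ} {Γ : List (Form (S ʳ) Ξ)} →
                 AssumesRel Ξ Γ → AssumesRel (σ ∷ Ξ) (Rel (var (here refl)) ∷ map wkF Γ)
  AssumesRel-∷ r (here refl) = here refl
  AssumesRel-∷ r (there x)   = there (subst (_∈ _) (Rel-renF there (var x)) (∈-map⁺ wkF (r x)))

module Relativization (S : Signature) (𝒜 : Theory S) (𝒜ʳ : Theory (S ʳ))
  (Rel-const : ∀ {σ} (c : Const S σ) → 𝒜ʳ ⊩ Rel {S} (const c))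
  (axiomʳ : ∀ A → 𝒜 A → 𝒜ʳ ⊩ (A ʳᶠ))
  (closed : ∀ σ → Term S [] σ) where

  closedʳ : ∀ σ → Term (S ʳ) [] σ
  closedʳ σ = toRT (closed σ)

  Rel-term : ∀ {Ξ Γ Δ σ} → AssumesRel Ξ Γ → (t : Term S Ξ σ) → Deriv 𝒜ʳ Ξ Γ (Rel (toRT t)) Δ
  Rel-term r (const c) = cast (Rel-renF _ (const c)) (⊩⇒Deriv closedʳ (Rel-const c))
  Rel-term r (var x)   = hyp (r x)
  Rel-term r (app t u) = cast Rel-app (∀ʳE (Rel-term r t) (toRT u) (Rel-term r u))
    where
    Rel-app : Rel (app (wkT (toRT t)) (var (here refl))) [ toRT u ] ≡ Rel (app (toRT t) (toRT u))
    Rel-app = trans (Rel-subF _ (app (wkT (toRT t)) _))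
                    (cong (λ v → Rel (app v (toRT u))) (single-wkT (toRT u) (toRT t)))

  relativize : ∀ {Ξ Γ Δ A Γ' Δ'} → Γ ⊆⟨ _ʳᶠ ⟩ Γ' → Δ ⊆⟨ _ʳᶠ ⟩ Δ' → AssumesRel Ξ Γ' →
               Deriv 𝒜 Ξ Γ A Δ → Deriv 𝒜ʳ Ξ Γ' (A ʳᶠ) Δ'
  relativize g d r (hyp m)           = hyp (g m)
  relativize g d r (axiom {A = A} a) = cast (sym (ʳᶠ-renF _ A)) (⊩⇒Deriv closedʳ (axiomʳ A a))
  relativize g d r (throw m D)       = throw (d m) (relativize g d r D)
  relativize g d r (catch n D)       = catch (Negative-ʳᶠ n) (relativize g (⊆⟨⟩-∷ d) r D)
  relativize g d r (⇒I D)            = ⇒I (relativize (⊆⟨⟩-∷ g) d (λ x → there (r x)) D)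
  relativize g d r (⇒E D E)          = ⇒E (relativize g d r D) (relativize g d r E)
  relativize g d r (∧I D E)          = ∧I (relativize g d r D) (relativize g d r E)
  relativize g d r (∧E₁ D)           = ∧E₁ (relativize g d r D)
  relativize g d r (∧E₂ D)           = ∧E₂ (relativize g d r D)
  relativize g d r (∀I D)            =
    ∀I (⇒I (relativize (λ m → there (⊆⟨⟩-map (ʳᶠ-renF there) g m))
                       (⊆⟨⟩-map (ʳᶠ-renF there) d) (AssumesRel-∷ r) D))
  relativize g d r (∀E {A = A} D t)  =
    cast (sym (ʳᶠ-[] A t)) (∀ʳE (relativize g d r D) (toRT t) (Rel-term r t))

  preserves-⊩ : ∀ A → 𝒜 ⊩ A → 𝒜ʳ ⊩ (A ʳᶠ)
  preserves-⊩ A ⊩A =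
    [] , cast (ʳᶠ-renF _ A) (relativize {Γ = []} {Δ = []} (λ ()) (λ ()) (λ ()) (⊩⇒Deriv closed ⊩A))

mainTheorem8 : (S : Signature) (𝒜 : Theory S) (𝒜ʳ : Theory (S ʳ)) →
    (∀ {σ} (c : Const S σ) → 𝒜ʳ ⊩ Rel {S} (const c)) →
    (∀ A → 𝒜 A → 𝒜ʳ ⊩ (A ʳᶠ)) →
    (∀ σ → Term S [] σ) →
    ∀ A → 𝒜 ⊩ A → 𝒜ʳ ⊩ (A ʳᶠ)
mainTheorem8 = Relativization.preserves-⊩
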